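{- Let $G=(V,E)$ be a finite undirected graph, let $T$ be a rooted spanning tree of $G$ with root $r_T$, and let $A\subset V$. Suppose $E(T)\cap\delta(A)=\{e_T(v_1),\dots,e_T(v_k)\}$ for some distinct vertices $v_1,\dots,v_k\in V\setminus\{r_T\}$. Then $$|\delta(A)|=\sum_{l=1}^{k}(-1)^{l-1}2^{l-1}\sum_{\substack{S'\subseteq[k]\\|S'|=l}}\Big|\bigcap_{i\in S'}\delta\big(v_i^{\downarrow T}\big)\Big|.$$
   Context: $E(T)$ is the set of edges of $T$. For a vertex $v\neq r_T$, $e_T(v)$ denotes the tree edge joining $v$ to its parent in $T$. For $v\in V$, $v^{\downarrow T}$ is the set of descendants of $v$ in $T$, including $v$ itself. For $B\subseteq V$, $\delta(B)$ is the set of edges of $G$ with exactly one endpoint in $B$ (the edges of the cut $(B,V\setminus B)$). $[k]=\{1,\dots,k\}$. -}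

module Defs where

open import Data.Bool using (Bool; true; false; _∧_; _xor_; if_then_else_)
open import Data.Nat as ℕ using (ℕ; zero; suc)
open import Data.Fin using (Fin; toℕ)
open import Data.Fin.Subset using (Subset; ∣_∣)
open import Data.Vec using (lookup; []; _∷_)
open import Data.List using (List; []; _∷_; _++_; map; filterᵇ; length; allFin; cartesianProduct; upTo; foldr)
open import Data.Bool.ListAction using (all; any)
open import Data.Nat.ListAction using (sum)
open import Data.Product using (_×_; _,_; ∃)
open import Data.Integer as ℤ using (ℤ)
open import Relation.Binary.PropositionalEquality using (_≡_; _≢_)
open import Relation.Nullary.Decidable using (⌊_⌋)

record Graph (n : ℕ) : Set where
  field
    adj     : Fin n → Fin n → Bool
    adj-sym : ∀ u v → adj u v ≡ adj v u
    adj-irr : ∀ v → adj v v ≡ false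
open Graph public

-- Each undirected edge {u,v} is represented once, as the pair (u , v) with u < v.
edges : ∀ {n} → Graph n → List (Fin n × Fin n)
edges {n} G = filterᵇ (λ { (u , v) → ⌊ toℕ u ℕ.<? toℕ v ⌋ ∧ adj G u v })
                      (cartesianProduct (allFin n) (allFin n))

_∈ᵇ_ : ∀ {n} → Fin n → Subset n → Bool
v ∈ᵇ B = lookup B v

inCut : ∀ {n} → Subset n → Fin n × Fin n → Bool
inCut B (u , v) = (u ∈ᵇ B) xor (v ∈ᵇ B)

cutSize : ∀ {n} → Graph n → Subset n → ℕ
cutSize G B = length (filterᵇ (inCut B) (edges G))

iter : ∀ {n} → (Fin n → Fin n) → ℕ → Fin n → Fin n
iter f zero    v = v
iter f (suc k) v = f (iter f k v)

-- Tree edges are e_T(v) = {v , parent v} for v ≠ r_T (convention: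
-- parent r_T = r_T); these must be edges of G, and every vertex reaches
-- the root by following parents (so the parent graph is acyclic and spanning).
record RootedSpanningTree {n : ℕ} (G : Graph n) : Set where
  field
    root        : Fin n
    parent      : Fin n → Fin n
    parent-root : parent root ≡ root
    parent-adj  : ∀ v → v ≢ root → adj G v (parent v) ≡ true
    reach-root  : ∀ v → ∃ λ k → iter parent k v ≡ root
open RootedSpanningTree public

-- Since every vertex reaches
-- the root in fewer than n steps, it suffices to check j < n.
desc : ∀ {n} {G : Graph n} → RootedSpanningTree G → Fin n → Subset n
desc {n} T v = Data.Vec.tabulate
  (λ u → any (λ j → ⌊ iter (parent T) j u Data.Fin.≟ v ⌋) (upTo n))
  where import Data.Vec; import Data.Fin

treeEdgeInCut : ∀ {n} {G : Graph n} → RootedSpanningTree G → Subset n → Fin n → Bool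
treeEdgeInCut T A v = (v ∈ᵇ A) xor (parent T v ∈ᵇ A)

allSubsets : (k : ℕ) → List (Subset k)
allSubsets zero    = [] ∷ []
allSubsets (suc k) = map (false ∷_) (allSubsets k) ++ map (true ∷_) (allSubsets k)

interCutSize : ∀ {n k} {G : Graph n} → RootedSpanningTree G → (Fin k → Fin n) → Subset k → ℕ
interCutSize {k = k} {G} T vs S' =
  length (filterᵇ (λ e → all (λ i → if i ∈ᵇ S' then inCut (desc T (vs i)) e else true) (allFin k))
                  (edges G))

layerSum : ∀ {n k} {G : Graph n} → RootedSpanningTree G → (Fin k → Fin n) → ℕ → ℕ
layerSum {k = k} T vs l =
  sum (map (interCutSize T vs) (filterᵇ (λ S' → ⌊ ∣ S' ∣ ℕ.≟ l ⌋) (allSubsets k)))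

-- Σ_{l=1}^{k} (-1)^{l-1} 2^{l-1} · layerSum l   (in ℤ), written with j = l-1
rhs : ∀ {n k} {G : Graph n} → RootedSpanningTree G → (Fin k → Fin n) → ℤ
rhs {k = k} T vs =
  foldr ℤ._+_ (ℤ.+ 0)
    (map (λ j → ((ℤ.- ℤ.+ 1) ℤ.^ j) ℤ.* ℤ.+ (2 ℕ.^ j) ℤ.* ℤ.+ layerSum T vs (suc j))
         (upTo k))

module Submission where

-- Let d(x) be the parity of the number of vᵢ with x ∈ vᵢ^{↓T}.  Going from a vertex to its
-- parent, membership in A changes exactly across the tree edges e_T(vᵢ), and so does d; hence
-- x ∈ A ⇔ (r_T ∈ A) xor d(x), and an edge lies in δ(A) iff it lies in an odd number of the cuts
-- δ(vᵢ^{↓T}).  An edge lying in exactly m of these cuts contributes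
-- Σ_{l≥1} (-2)^{l-1} C(m,l) = (1 - (-1)^m)/2 to the right-hand side: 1 if m is odd, 0 otherwise.

open import Defs
open import Data.Nat using (ℕ)
open import Data.Fin using (Fin)
open import Data.Fin.Subset using (Subset)
open import Data.Product using (∃)
open import Data.Bool using (true)
open import Data.Integer using (ℤ; +_)
open import Function using (Injective; _⇔_)
open import Relation.Binary.PropositionalEquality using (_≡_; _≢_)

open import Algebra.Bundles using (CommutativeRing)
import Algebra.Properties.CommutativeMonoid.Sum as CommutativeMonoidSum
import Algebra.Properties.Semiring.Sum as SemiringSum
open import Data.Bool using (Bool; false; not; _∧_; _xor_; if_then_else_) renaming (T to IsTrue)
open import Data.Bool.Properties
  using ( xor-∧-commutativeRing; not-involutive; xor-annihilates-not; xor-assoc; xor-same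
        ; xor-identityʳ; ¬-not; ⇔→≡; T-≡)
open import Data.Bool.ListAction using (all; any; and)
open import Data.Empty using (⊥-elim)
open import Data.Fin as Fin using (toℕ; _≟_; punchIn)
open import Data.Fin.Properties using (pigeonhole; punchInᵢ≢i; toℕ≤pred[n])
open import Data.Fin.Subset using (∣_∣)
open import Data.Integer as ℤ using (-[1+_])
import Data.Integer.Properties as ℤ
open import Data.Integer.Tactic.RingSolver using (solve-∀)
open import Data.List using (List; []; _∷_; _++_; map; filterᵇ; length; allFin; applyUpTo; upTo; foldr)
open import Data.List.Membership.Propositional using (lose)
open import Data.List.Membership.Propositional.Properties using (∈-upTo⁺)
open import Data.List.Properties
  using (filter-++; filter-≐; filter-none; length-++; length-map; map-cong; map-tabulate)
open import Data.List.Relation.Unary.All as All using ()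
open import Data.List.Relation.Unary.Any using (satisfied)
open import Data.List.Relation.Unary.Any.Properties using (any⁺; any⁻)
open import Data.Nat using (zero; suc; pred; _^_; _+_; _*_; _∸_; _<_; _≤_; s≤s)
open import Data.Nat.ListAction using (sum)
import Data.Nat.Properties as ℕ
open import Algebra.Properties.CommutativeSemigroup ℕ.+-commutativeSemigroup
  using () renaming (interchange to +-interchange)
open import Data.Product using (_×_; _,_; proj₁; proj₂)
import Data.Vec as Vec
import Data.Vec.Properties as Vec
open import Function using (_∘_; mk⇔; Equivalence)
open import Relation.Binary.PropositionalEquality
  using (refl; sym; trans; cong; cong₂; subst; _≗_; module ≡-Reasoning)
open import Relation.Nullary using (Dec; yes; no; ¬_)
open import Relation.Nullary.Decidable using (⌊_⌋; T?; toWitness; fromWitness; dec-true; dec-false; isYes≗does)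

boolToℕ : Bool → ℕ
boolToℕ false = 0
boolToℕ true  = 1

⌊⌋-yes : ∀ {P : Set} (d : Dec P) → P → ⌊ d ⌋ ≡ true
⌊⌋-yes d p = trans (isYes≗does d) (dec-true d p)

⌊⌋-no : ∀ {P : Set} (d : Dec P) → ¬ P → ⌊ d ⌋ ≡ false
⌊⌋-no d ¬p = trans (isYes≗does d) (dec-false d ¬p)

xor-cancelˡ : ∀ a b → a xor (a xor b) ≡ b
xor-cancelˡ false b = refl
xor-cancelˡ true  b = not-involutive b

xor-cancelʳ : ∀ a b → (a xor b) xor b ≡ a
xor-cancelʳ a b = trans (xor-assoc a b b) (trans (cong (a xor_) (xor-same b)) (xor-identityʳ a))

xor-cancel-common : ∀ c a b → (c xor a) xor (c xor b) ≡ a xor b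
xor-cancel-common false a b = refl
xor-cancel-common true  a b = xor-annihilates-not a b

module Parity = CommutativeMonoidSum (CommutativeRing.+-commutativeMonoid xor-∧-commutativeRing)

parity : ∀ {k} → (Fin k → Bool) → Bool
parity = Parity.sum

parity-false : ∀ {k} {b : Fin k → Bool} → (∀ i → b i ≡ false) → parity b ≡ false
parity-false {k} b≡false = trans (Parity.sum-cong-≗ b≡false) (Parity.sum-replicate-zero k)

parity-single : ∀ {k} {b : Fin k → Bool} i →
                b i ≡ true → (∀ j → j ≢ i → b j ≡ false) → parity b ≡ true
parity-single {suc k} {b} i bᵢ others =
  trans (Parity.sum-remove {i = i} b)
        (cong₂ _xor_ bᵢ (parity-false (λ j → others (punchIn i j) (punchInᵢ≢i i j))))

filterᵇ-cong : ∀ {A : Set} {p q : A → Bool} → p ≗ q → filterᵇ p ≗ filterᵇ q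
filterᵇ-cong {p = p} {q} p≗q =
  filter-≐ (T? ∘ p) (T? ∘ q) ((λ {x} → subst IsTrue (p≗q x)) , (λ {x} → subst IsTrue (sym (p≗q x))))

filterᵇ-map : ∀ {A B : Set} (p : B → Bool) (f : A → B) xs →
              filterᵇ p (map f xs) ≡ map f (filterᵇ (p ∘ f) xs)
filterᵇ-map p f [] = refl
filterᵇ-map p f (x ∷ xs) with p (f x)
... | true  = cong (f x ∷_) (filterᵇ-map p f xs)
... | false = filterᵇ-map p f xs

length-filterᵇ-∷ : ∀ {A : Set} (p : A → Bool) x xs →
                   length (filterᵇ p (x ∷ xs)) ≡ boolToℕ (p x) + length (filterᵇ p xs)
length-filterᵇ-∷ p x xs with p x
... | true  = refl
... | false = refl

length-filterᵇ : ∀ {A : Set} (p : A → Bool) xs → length (filterᵇ p xs) ≡ sum (map (boolToℕ ∘ p) xs)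
length-filterᵇ p [] = refl
length-filterᵇ p (x ∷ xs) =
  trans (length-filterᵇ-∷ p x xs) (cong (_+_ (boolToℕ (p x))) (length-filterᵇ p xs))

sum-map-+ : ∀ {A : Set} (f g : A → ℕ) xs →
            sum (map (λ x → f x + g x) xs) ≡ sum (map f xs) + sum (map g xs)
sum-map-+ f g [] = refl
sum-map-+ f g (x ∷ xs) = trans (cong (_+_ (f x + g x)) (sum-map-+ f g xs)) (+-interchange (f x) (g x) _ _)

sum-map-zero : ∀ {A : Set} (xs : List A) → sum (map (λ _ → 0) xs) ≡ 0
sum-map-zero [] = refl
sum-map-zero (x ∷ xs) = sum-map-zero xs

filterᵇ-false : ∀ {A : Set} (xs : List A) → filterᵇ (λ _ → false) xs ≡ []
filterᵇ-false xs = filter-none (T? ∘ (λ _ → false)) (All.universal (λ _ ()) xs)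

length-filterᵇ-map : ∀ {A B : Set} (p : B → Bool) (f : A → B) xs →
                     length (filterᵇ p (map f xs)) ≡ length (filterᵇ (p ∘ f) xs)
length-filterᵇ-map p f xs = trans (cong length (filterᵇ-map p f xs)) (length-map f (filterᵇ (p ∘ f) xs))

length-filterᵇ-++ : ∀ {A : Set} (p : A → Bool) xs ys →
                    length (filterᵇ p (xs ++ ys)) ≡ length (filterᵇ p xs) + length (filterᵇ p ys)
length-filterᵇ-++ p xs ys = trans (cong length (filter-++ (T? ∘ p) xs ys)) (length-++ (filterᵇ p xs))

length-filterᵇ-∧ : ∀ {A : Set} c (p : A → Bool) xs →
                   length (filterᵇ (λ x → c ∧ p x) xs) ≡ (if c then length (filterᵇ p xs) else 0)
length-filterᵇ-∧ true  p xs = refl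
length-filterᵇ-∧ false p xs = cong length (filterᵇ-false xs)

-- Subsets of [k] inside a Boolean vector

all-allFin-suc : ∀ {k} (p : Fin (suc k) → Bool) →
                 all p (allFin (suc k)) ≡ p Fin.zero ∧ all (p ∘ Fin.suc) (allFin k)
all-allFin-suc p = cong (λ bs → p Fin.zero ∧ and bs)
  (trans (map-tabulate Fin.suc p) (sym (map-tabulate (λ i → i) (p ∘ Fin.suc))))

_⊆ᵇ_ : ∀ {k} → Subset k → (Fin k → Bool) → Bool
_⊆ᵇ_ {k} S b = all (λ i → if i ∈ᵇ S then b i else true) (allFin k)

false∷⊆ᵇ : ∀ {k} (S : Subset k) b → (false Vec.∷ S) ⊆ᵇ b ≡ S ⊆ᵇ (b ∘ Fin.suc)
false∷⊆ᵇ S b = all-allFin-suc (λ i → if i ∈ᵇ (false Vec.∷ S) then b i else true)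

true∷⊆ᵇ : ∀ {k} (S : Subset k) b → (true Vec.∷ S) ⊆ᵇ b ≡ b Fin.zero ∧ S ⊆ᵇ (b ∘ Fin.suc)
true∷⊆ᵇ S b = all-allFin-suc (λ i → if i ∈ᵇ (true Vec.∷ S) then b i else true)

ofSize : ∀ {k} → ℕ → Subset k → Bool
ofSize l S = ⌊ ∣ S ∣ ℕ.≟ l ⌋

ofSize-true∷ : ∀ {k} l (S : Subset k) → ofSize (suc l) (true Vec.∷ S) ≡ ofSize l S
ofSize-true∷ l S = trans (isYes≗does (suc ∣ S ∣ ℕ.≟ suc l)) (sym (isYes≗does (∣ S ∣ ℕ.≟ l)))

#subsetsOf : ∀ {k} → (Fin k → Bool) → ℕ → ℕ
#subsetsOf {k} b l = length (filterᵇ (_⊆ᵇ b) (filterᵇ (ofSize l) (allSubsets k)))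

#subsetsOf-split : ∀ {k} (b : Fin (suc k) → Bool) l →
  #subsetsOf b l ≡ #subsetsOf (b ∘ Fin.suc) l
                 + (if b Fin.zero
                    then length (filterᵇ (_⊆ᵇ (b ∘ Fin.suc)) (filterᵇ (ofSize l ∘ (true Vec.∷_)) (allSubsets k)))
                    else 0)
#subsetsOf-split {k} b l = begin
    length (filterᵇ (_⊆ᵇ b) (filterᵇ (ofSize l) (map (false Vec.∷_) Ss ++ map (true Vec.∷_) Ss)))
  ≡⟨ cong (length ∘ filterᵇ (_⊆ᵇ b))
          (trans (filter-++ (T? ∘ ofSize l) (map (false Vec.∷_) Ss) _)
                 (cong₂ _++_ (filterᵇ-map (ofSize l) _ Ss) (filterᵇ-map (ofSize l) _ Ss))) ⟩
    length (filterᵇ (_⊆ᵇ b) (map (false Vec.∷_) Sᶠ ++ map (true Vec.∷_) Sᵗ))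
  ≡⟨ length-filterᵇ-++ (_⊆ᵇ b) (map (false Vec.∷_) Sᶠ) _ ⟩
    length (filterᵇ (_⊆ᵇ b) (map (false Vec.∷_) Sᶠ)) + length (filterᵇ (_⊆ᵇ b) (map (true Vec.∷_) Sᵗ))
  ≡⟨ cong₂ _+_ (length-filterᵇ-map (_⊆ᵇ b) _ Sᶠ) (length-filterᵇ-map (_⊆ᵇ b) _ Sᵗ) ⟩
    length (filterᵇ (λ S → (false Vec.∷ S) ⊆ᵇ b) Sᶠ) + length (filterᵇ (λ S → (true Vec.∷ S) ⊆ᵇ b) Sᵗ)
  ≡⟨ cong₂ _+_ (cong length (filterᵇ-cong (λ S → false∷⊆ᵇ S b) Sᶠ))
               (trans (cong length (filterᵇ-cong (λ S → true∷⊆ᵇ S b) Sᵗ))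
                      (length-filterᵇ-∧ (b Fin.zero) (_⊆ᵇ (b ∘ Fin.suc)) Sᵗ)) ⟩
    #subsetsOf (b ∘ Fin.suc) l + (if b Fin.zero then length (filterᵇ (_⊆ᵇ (b ∘ Fin.suc)) Sᵗ) else 0)
  ∎
  where
  open ≡-Reasoning
  Ss = allSubsets k
  Sᶠ = filterᵇ (ofSize l) Ss
  Sᵗ = filterᵇ (ofSize l ∘ (true Vec.∷_)) Ss

#subsetsOf-zero : ∀ {k} (b : Fin k → Bool) → #subsetsOf b 0 ≡ 1
#subsetsOf-zero {zero} b = refl
#subsetsOf-zero {suc k} b = trans (#subsetsOf-split b 0) (cong₂ _+_ (#subsetsOf-zero (b ∘ Fin.suc)) no-nonempty)
  where
  no-nonempty : (if b Fin.zero then length (filterᵇ _ (filterᵇ (λ _ → false) (allSubsets k))) else 0) ≡ 0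
  no-nonempty with b Fin.zero
  ... | true  = cong (length ∘ filterᵇ _) (filterᵇ-false (allSubsets k))
  ... | false = refl

#subsetsOf-suc : ∀ {k} (b : Fin (suc k) → Bool) l →
                 #subsetsOf b (suc l) ≡ #subsetsOf (b ∘ Fin.suc) (suc l)
                                      + (if b Fin.zero then #subsetsOf (b ∘ Fin.suc) l else 0)
#subsetsOf-suc {k} b l =
  trans (#subsetsOf-split b (suc l))
        (cong (λ Sᵗ → #subsetsOf (b ∘ Fin.suc) (suc l)
                      + (if b Fin.zero then length (filterᵇ (_⊆ᵇ (b ∘ Fin.suc)) Sᵗ) else 0))
              (filterᵇ-cong (ofSize-true∷ l) (allSubsets k)))

-- Alternating sums

module ℤSum = SemiringSum ℤ.+-*-semiring
open ℤSum using (sum-syntax)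

alternatingTerm : (ℕ → ℕ) → ℕ → ℤ
alternatingTerm f j = -[1+ 1 ] ℤ.^ j ℤ.* + f (suc j)

alternatingSum : (ℕ → ℕ) → ℕ → ℤ
alternatingSum f N = ∑[ j < N ] alternatingTerm f (toℕ j)

alternatingSum-cong : ∀ {f g : ℕ → ℕ} → (∀ l → f (suc l) ≡ g (suc l)) → ∀ N →
                      alternatingSum f N ≡ alternatingSum g N
alternatingSum-cong {f} {g} f≗g N =
  ℤSum.sum-cong-≗ {N} {x = alternatingTerm f ∘ toℕ} {y = alternatingTerm g ∘ toℕ}
                  (λ j → cong (λ m → -[1+ 1 ] ℤ.^ toℕ j ℤ.* + m) (f≗g (toℕ j)))

alternatingSum-zero : ∀ {f : ℕ → ℕ} → (∀ l → f (suc l) ≡ 0) → ∀ N → alternatingSum f N ≡ + 0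
alternatingSum-zero {f} f≡0 N =
  trans (alternatingSum-cong {f} {λ _ → 0} f≡0 N)
        (trans (ℤSum.sum-cong-≗ {N} {x = alternatingTerm (λ _ → 0) ∘ toℕ} {y = λ _ → + 0}
                                (λ j → ℤ.*-zeroʳ (-[1+ 1 ] ℤ.^ toℕ j)))
               (ℤSum.sum-replicate-zero N))

alternatingSum-+ : ∀ (f g : ℕ → ℕ) N →
                   alternatingSum (λ l → f l + g l) N ≡ alternatingSum f N ℤ.+ alternatingSum g N
alternatingSum-+ f g N =
  trans (ℤSum.sum-cong-≗ {N} {x = alternatingTerm (λ l → f l + g l) ∘ toℕ}
                         {y = λ j → alternatingTerm f (toℕ j) ℤ.+ alternatingTerm g (toℕ j)}
                         (λ j → ℤ.*-distribˡ-+ (-[1+ 1 ] ℤ.^ toℕ j) (+ f (suc (toℕ j))) (+ g (suc (toℕ j)))))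
        (ℤSum.∑-distrib-+ {N} (alternatingTerm f ∘ toℕ) (alternatingTerm g ∘ toℕ))

alternatingSum-pred : ∀ (f : ℕ → ℕ) N →
                      alternatingSum (f ∘ pred) (suc N) ≡ + f 0 ℤ.+ -[1+ 1 ] ℤ.* alternatingSum f N
alternatingSum-pred f N = begin
    alternatingTerm (f ∘ pred) 0 ℤ.+ ∑[ j < N ] alternatingTerm (f ∘ pred) (suc (toℕ j))
  ≡⟨ cong₂ ℤ._+_ (ℤ.*-identityˡ (+ f 0))
                 (ℤSum.sum-cong-≗ {N} {x = alternatingTerm (f ∘ pred) ∘ suc ∘ toℕ}
                                  {y = λ j → -[1+ 1 ] ℤ.* alternatingTerm f (toℕ j)}
                                  (λ j → ℤ.*-assoc -[1+ 1 ] (-[1+ 1 ] ℤ.^ toℕ j) (+ f (suc (toℕ j))))) ⟩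
    + f 0 ℤ.+ ∑[ j < N ] (-[1+ 1 ] ℤ.* alternatingTerm f (toℕ j))
  ≡⟨ cong (ℤ._+_ (+ f 0)) (sym (ℤSum.*-distribˡ-sum {N} -[1+ 1 ] (alternatingTerm f ∘ toℕ))) ⟩
    + f 0 ℤ.+ -[1+ 1 ] ℤ.* alternatingSum f N
  ∎
  where open ≡-Reasoning

+boolToℕ-not : ∀ x → + boolToℕ x ℤ.+ (+ 1 ℤ.+ -[1+ 1 ] ℤ.* + boolToℕ x) ≡ + boolToℕ (not x)
+boolToℕ-not false = refl
+boolToℕ-not true  = refl

alternatingSum-#subsetsOf : ∀ {k} (b : Fin k → Bool) N → k ≤ N →
                            alternatingSum (#subsetsOf b) N ≡ + boolToℕ (parity b)
alternatingSum-#subsetsOf {zero} b N _ = alternatingSum-zero {#subsetsOf b} (λ l → refl) N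
alternatingSum-#subsetsOf {suc k} b (suc N) (s≤s k≤N) = by-first-bit (b Fin.zero) (#subsetsOf-suc b)
  where
  open ≡-Reasoning
  b′ : Fin k → Bool
  b′ = b ∘ Fin.suc
  L′ : ℕ → ℕ
  L′ = #subsetsOf b′
  x : Bool
  x = parity b′
  IH : ∀ {M} → k ≤ M → alternatingSum L′ M ≡ + boolToℕ x
  IH {M} = alternatingSum-#subsetsOf b′ M

  -- With x the parity of the remaining coordinates the sum is x + b₀ (1 - 2x).
  by-first-bit : ∀ b₀ → (∀ l → #subsetsOf b (suc l) ≡ L′ (suc l) + (if b₀ then L′ l else 0)) →
                 alternatingSum (#subsetsOf b) (suc N) ≡ + boolToℕ (b₀ xor x)
  by-first-bit false split =
    trans (alternatingSum-cong {#subsetsOf b} {L′} (λ l → trans (split l) (ℕ.+-identityʳ _)) (suc N))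
          (IH (ℕ.m≤n⇒m≤1+n k≤N))
  by-first-bit true split = begin
      alternatingSum (#subsetsOf b) (suc N)
    ≡⟨ alternatingSum-cong {#subsetsOf b} {λ l → L′ l + L′ (pred l)} split (suc N) ⟩
      alternatingSum (λ l → L′ l + L′ (pred l)) (suc N)
    ≡⟨ alternatingSum-+ L′ (L′ ∘ pred) (suc N) ⟩
      alternatingSum L′ (suc N) ℤ.+ alternatingSum (L′ ∘ pred) (suc N)
    ≡⟨ cong₂ ℤ._+_ (IH (ℕ.m≤n⇒m≤1+n k≤N)) (alternatingSum-pred L′ N) ⟩
      + boolToℕ x ℤ.+ (+ L′ 0 ℤ.+ -[1+ 1 ] ℤ.* alternatingSum L′ N)
    ≡⟨ cong₂ (λ m s → + boolToℕ x ℤ.+ (+ m ℤ.+ -[1+ 1 ] ℤ.* s)) (#subsetsOf-zero b′) (IH k≤N) ⟩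
      + boolToℕ x ℤ.+ (+ 1 ℤ.+ -[1+ 1 ] ℤ.* + boolToℕ x)
    ≡⟨ +boolToℕ-not x ⟩
      + boolToℕ (not x)
    ∎

module _ {E : Set} {k : ℕ} (q : E → Fin k → Bool) where

  layerCount : List E → ℕ → ℕ
  layerCount es l =
    sum (map (λ S → length (filterᵇ (λ e → S ⊆ᵇ q e) es)) (filterᵇ (ofSize l) (allSubsets k)))

  layerCount-[] : ∀ l → layerCount [] l ≡ 0
  layerCount-[] l = sum-map-zero (filterᵇ (ofSize l) (allSubsets k))

  layerCount-∷ : ∀ e es l → layerCount (e ∷ es) l ≡ #subsetsOf (q e) l + layerCount es l
  layerCount-∷ e es l = begin
      sum (map (λ S → length (filterᵇ (λ e → S ⊆ᵇ q e) (e ∷ es))) Sₗ)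
    ≡⟨ cong sum (map-cong (λ S → length-filterᵇ-∷ (λ e → S ⊆ᵇ q e) e es) Sₗ) ⟩
      sum (map (λ S → boolToℕ (S ⊆ᵇ q e) + length (filterᵇ (λ e → S ⊆ᵇ q e) es)) Sₗ)
    ≡⟨ sum-map-+ (boolToℕ ∘ (_⊆ᵇ q e)) (λ S → length (filterᵇ (λ e → S ⊆ᵇ q e) es)) Sₗ ⟩
      sum (map (boolToℕ ∘ (_⊆ᵇ q e)) Sₗ) + layerCount es l
    ≡⟨ cong (_+ layerCount es l) (sym (length-filterᵇ (_⊆ᵇ q e) Sₗ)) ⟩
      #subsetsOf (q e) l + layerCount es l
    ∎
    where
    open ≡-Reasoning
    Sₗ = filterᵇ (ofSize l) (allSubsets k)

  alternatingSum-layerCount : ∀ es → alternatingSum (layerCount es) k ≡ + length (filterᵇ (parity ∘ q) es)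
  alternatingSum-layerCount [] = alternatingSum-zero {layerCount []} (layerCount-[] ∘ suc) k
  alternatingSum-layerCount (e ∷ es) = begin
      alternatingSum (layerCount (e ∷ es)) k
    ≡⟨ alternatingSum-cong {layerCount (e ∷ es)} {λ l → #subsetsOf (q e) l + layerCount es l}
                           (layerCount-∷ e es ∘ suc) k ⟩
      alternatingSum (λ l → #subsetsOf (q e) l + layerCount es l) k
    ≡⟨ alternatingSum-+ (#subsetsOf (q e)) (layerCount es) k ⟩
      alternatingSum (#subsetsOf (q e)) k ℤ.+ alternatingSum (layerCount es) k
    ≡⟨ cong₂ ℤ._+_ (alternatingSum-#subsetsOf (q e) k ℕ.≤-refl) (alternatingSum-layerCount es) ⟩
      + boolToℕ (parity (q e)) ℤ.+ + length (filterᵇ (parity ∘ q) es)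
    ≡⟨ cong +_ (sym (length-filterᵇ-∷ (parity ∘ q) e es)) ⟩
      + length (filterᵇ (parity ∘ q) (e ∷ es))
    ∎
    where open ≡-Reasoning

foldr-+-applyUpTo : ∀ (f : ℕ → ℤ) (g : ℕ → ℕ) N →
                    foldr ℤ._+_ (+ 0) (map f (applyUpTo g N)) ≡ ∑[ j < N ] f (g (toℕ j))
foldr-+-applyUpTo f g zero    = refl
foldr-+-applyUpTo f g (suc N) = cong (ℤ._+_ (f (g 0))) (foldr-+-applyUpTo f (g ∘ suc) N)

[-1]^j*2^j≡[-2]^j : ∀ j → (ℤ.- + 1) ℤ.^ j ℤ.* + (2 ^ j) ≡ -[1+ 1 ] ℤ.^ j
[-1]^j*2^j≡[-2]^j zero    = refl
[-1]^j*2^j≡[-2]^j (suc j) = begin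
    (ℤ.- + 1) ℤ.* (ℤ.- + 1) ℤ.^ j ℤ.* + (2 * 2 ^ j)
  ≡⟨ cong ((ℤ.- + 1) ℤ.* (ℤ.- + 1) ℤ.^ j ℤ.*_) (ℤ.pos-* 2 (2 ^ j)) ⟩
    (ℤ.- + 1) ℤ.* (ℤ.- + 1) ℤ.^ j ℤ.* (+ 2 ℤ.* + (2 ^ j))
  ≡⟨ regroup ((ℤ.- + 1) ℤ.^ j) (+ (2 ^ j)) ⟩
    -[1+ 1 ] ℤ.* ((ℤ.- + 1) ℤ.^ j ℤ.* + (2 ^ j))
  ≡⟨ cong (-[1+ 1 ] ℤ.*_) ([-1]^j*2^j≡[-2]^j j) ⟩
    -[1+ 1 ] ℤ.* -[1+ 1 ] ℤ.^ j
  ∎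
  where
  open ≡-Reasoning
  regroup : ∀ u v → (ℤ.- + 1) ℤ.* u ℤ.* (+ 2 ℤ.* v) ≡ -[1+ 1 ] ℤ.* (u ℤ.* v)
  regroup = solve-∀

foldr-upTo≡alternatingSum : ∀ (f : ℕ → ℕ) N →
  foldr ℤ._+_ (+ 0) (map (λ j → (ℤ.- + 1) ℤ.^ j ℤ.* + (2 ^ j) ℤ.* + f (suc j)) (upTo N))
  ≡ alternatingSum f N
foldr-upTo≡alternatingSum f N =
  trans (foldr-+-applyUpTo _ (λ j → j) N)
        (ℤSum.sum-cong-≗ {N} {x = λ j → (ℤ.- + 1) ℤ.^ toℕ j ℤ.* + (2 ^ toℕ j) ℤ.* + f (suc (toℕ j))}
                         {y = alternatingTerm f ∘ toℕ}
                         (λ j → cong (ℤ._* + f (suc (toℕ j))) ([-1]^j*2^j≡[-2]^j (toℕ j))))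

-- The parent map of a rooted tree

module _ {n : ℕ} (f : Fin n → Fin n) where

  iter-+ : ∀ a b x → iter f (a + b) x ≡ iter f a (iter f b x)
  iter-+ zero    b x = refl
  iter-+ (suc a) b x = cong f (iter-+ a b x)

  iter-sucʳ : ∀ j x → iter f (suc j) x ≡ iter f j (f x)
  iter-sucʳ zero    x = refl
  iter-sucʳ (suc j) x = cong f (iter-sucʳ j x)

  iter-fixed : ∀ {c} → f c ≡ c → ∀ j → iter f j c ≡ c
  iter-fixed fc≡c zero    = refl
  iter-fixed fc≡c (suc j) = trans (cong f (iter-fixed fc≡c j)) fc≡c

  iter-absorbed : ∀ {c x a m} → f c ≡ c → iter f a x ≡ c → a ≤ m → iter f m x ≡ c
  iter-absorbed {c} {x} {a} {m} fc≡c reach a≤m = begin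
      iter f m x                   ≡⟨ cong (λ j → iter f j x) (sym (ℕ.m∸n+n≡m a≤m)) ⟩
      iter f (m ∸ a + a) x         ≡⟨ iter-+ (m ∸ a) a x ⟩
      iter f (m ∸ a) (iter f a x)  ≡⟨ cong (iter f (m ∸ a)) reach ⟩
      iter f (m ∸ a) c             ≡⟨ iter-fixed fc≡c (m ∸ a) ⟩
      c                            ∎
    where open ≡-Reasoning

  iter-periodic : ∀ {y} d → iter f (suc d) y ≡ y → ∀ m → iter f (m * suc d) y ≡ y
  iter-periodic d cyc zero    = refl
  iter-periodic {y} d cyc (suc m) =
    trans (iter-+ (suc d) (m * suc d) y) (trans (cong (iter f (suc d)) (iter-periodic d cyc m)) cyc)

module _ {n : ℕ} {G : Graph n} (T : RootedSpanningTree G) where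

  periodic⇒root : ∀ y d → iter (parent T) (suc d) y ≡ y → y ≡ root T
  periodic⇒root y d cyc = begin
      y                                           ≡⟨ sym (iter-periodic (parent T) d cyc K) ⟩
      iter (parent T) (K * suc d) y               ≡⟨ cong (λ j → iter (parent T) j y) K*[1+d]≡K*d+K ⟩
      iter (parent T) (K * d + K) y               ≡⟨ iter-+ (parent T) (K * d) K y ⟩
      iter (parent T) (K * d) (iter (parent T) K y) ≡⟨ cong (iter (parent T) (K * d)) (proj₂ (reach-root T y)) ⟩
      iter (parent T) (K * d) (root T)            ≡⟨ iter-fixed (parent T) (parent-root T) (K * d) ⟩
      root T                                      ∎
    where
    open ≡-Reasoning
    K : ℕ
    K = proj₁ (reach-root T y)
    K*[1+d]≡K*d+K : K * suc d ≡ K * d + K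
    K*[1+d]≡K*d+K = trans (ℕ.*-suc K d) (ℕ.+-comm K (K * d))

  -- Two of x, parent x, …, parentⁿ x coincide, and a vertex that recurs lies on a cycle of
  -- the parent map, so it is the root.
  iter-size≡root : ∀ x → iter (parent T) n x ≡ root T
  iter-size≡root x with pigeonhole (ℕ.n<1+n n) (λ (i : Fin (suc n)) → iter (parent T) (toℕ i) x)
  ... | i , j , i<j , same =
    iter-absorbed (parent T) (parent-root T) (periodic⇒root (iter (parent T) (toℕ i) x) d cyc)
                  (ℕ.<⇒≤ (ℕ.<-≤-trans i<j (toℕ≤pred[n] j)))
    where
    d : ℕ
    d = toℕ j ∸ suc (toℕ i)
    cyc : iter (parent T) (suc d) (iter (parent T) (toℕ i) x) ≡ iter (parent T) (toℕ i) x
    cyc = begin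
        iter (parent T) (suc d) (iter (parent T) (toℕ i) x) ≡⟨ sym (iter-+ (parent T) (suc d) (toℕ i) x) ⟩
        iter (parent T) (suc d + toℕ i) x                  ≡⟨ cong (λ m → iter (parent T) m x) [1+d]+i≡j ⟩
        iter (parent T) (toℕ j) x                          ≡⟨ sym same ⟩
        iter (parent T) (toℕ i) x                          ∎
      where
      open ≡-Reasoning
      [1+d]+i≡j : suc d + toℕ i ≡ toℕ j
      [1+d]+i≡j = trans (sym (ℕ.+-suc d (toℕ i))) (ℕ.m∸n+n≡m i<j)

  tree-induction : (P : Fin n → Set) → P (root T) →
                   (∀ x → x ≢ root T → P (parent T x) → P x) → ∀ x → P x
  tree-induction P P-root P-step x = go (proj₁ (reach-root T x)) x (proj₂ (reach-root T x))
    where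
    go : ∀ j x → iter (parent T) j x ≡ root T → P x
    go j x reach with x ≟ root T
    go j       x reach | yes refl = P-root
    go zero    x reach | no x≢r   = ⊥-elim (x≢r reach)
    go (suc j) x reach | no x≢r   =
      P-step x x≢r (go j (parent T x) (trans (sym (iter-sucʳ (parent T) j x)) reach))

  ∈desc⇔ : ∀ {u v} → v ≢ root T → (u ∈ᵇ desc T v ≡ true ⇔ ∃ λ j → iter (parent T) j u ≡ v)
  ∈desc⇔ {u} {v} v≢r = mk⇔ to from
    where
    reaches? : ℕ → Bool
    reaches? j = ⌊ iter (parent T) j u ≟ v ⌋
    unfold : u ∈ᵇ desc T v ≡ any reaches? (upTo n)
    unfold = Vec.lookup∘tabulate (λ w → any (λ j → ⌊ iter (parent T) j w ≟ v ⌋) (upTo n)) u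
    bound : ∀ j → iter (parent T) j u ≡ v → j < n
    bound j reach with j ℕ.<? n
    ... | yes j<n = j<n
    ... | no  j≮n = ⊥-elim (v≢r (trans (sym reach)
                      (iter-absorbed (parent T) (parent-root T) (iter-size≡root u) (ℕ.≮⇒≥ j≮n))))
    to : u ∈ᵇ desc T v ≡ true → ∃ λ j → iter (parent T) j u ≡ v
    to u∈ with satisfied (any⁻ reaches? (upTo n) (Equivalence.from T-≡ (trans (sym unfold) u∈)))
    ... | j , reach = j , toWitness reach
    from : (∃ λ j → iter (parent T) j u ≡ v) → u ∈ᵇ desc T v ≡ true
    from (j , reach) =
      trans unfold (Equivalence.to T-≡ (any⁺ reaches? (lose (∈-upTo⁺ (bound j reach)) (fromWitness reach))))

  root∉desc : ∀ {v} → v ≢ root T → root T ∈ᵇ desc T v ≡ false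
  root∉desc v≢r = ¬-not λ r∈ →
    let (j , reach) = Equivalence.to (∈desc⇔ v≢r) r∈
    in v≢r (trans (sym reach) (iter-fixed (parent T) (parent-root T) j))

  ∈desc-parent : ∀ {x v} → x ≢ root T → v ≢ root T →
                 x ∈ᵇ desc T v ≡ ⌊ x ≟ v ⌋ xor (parent T x ∈ᵇ desc T v)
  ∈desc-parent {x} {v} x≢r v≢r with x ≟ v
  ... | yes refl = trans (Equivalence.from (∈desc⇔ v≢r) (0 , refl)) (cong not (sym parent∉desc))
    where
    parent∉desc : parent T x ∈ᵇ desc T x ≡ false
    parent∉desc = ¬-not λ px∈ →
      let (j , reach) = Equivalence.to (∈desc⇔ v≢r) px∈
      in x≢r (periodic⇒root x j (trans (iter-sucʳ (parent T) j x) reach))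
  ... | no x≢v = ⇔→≡ (mk⇔ to from)
    where
    to : x ∈ᵇ desc T v ≡ true → parent T x ∈ᵇ desc T v ≡ true
    to x∈ with Equivalence.to (∈desc⇔ v≢r) x∈
    ... | zero  , x≡v   = ⊥-elim (x≢v x≡v)
    ... | suc j , reach = Equivalence.from (∈desc⇔ v≢r) (j , trans (sym (iter-sucʳ (parent T) j x)) reach)
    from : parent T x ∈ᵇ desc T v ≡ true → x ∈ᵇ desc T v ≡ true
    from px∈ with Equivalence.to (∈desc⇔ v≢r) px∈
    ... | j , reach = Equivalence.from (∈desc⇔ v≢r) (suc j , trans (iter-sucʳ (parent T) j x) reach)

-- Cuts

module _ {n k : ℕ} {G : Graph n} (T : RootedSpanningTree G) (A : Subset n) (vs : Fin k → Fin n)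
         (vs-injective : Injective _≡_ _≡_ vs) (vs≢root : ∀ i → vs i ≢ root T)
         (cut-tree-edges : ∀ v → v ≢ root T → (treeEdgeInCut T A v ≡ true ⇔ ∃ λ i → vs i ≡ v)) where

  depthParity : Fin n → Bool
  depthParity x = parity (λ i → x ∈ᵇ desc T (vs i))

  treeEdgeInCut≡parity : ∀ x → x ≢ root T → treeEdgeInCut T A x ≡ parity (λ i → ⌊ x ≟ vs i ⌋)
  treeEdgeInCut≡parity x x≢r with treeEdgeInCut T A x in e
  ... | true =
    let (i , vsᵢ≡x) = Equivalence.to (cut-tree-edges x x≢r) e
    in sym (parity-single i (⌊⌋-yes (x ≟ vs i) (sym vsᵢ≡x))
                            (λ j j≢i → ⌊⌋-no (x ≟ vs j) (λ x≡vsⱼ →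
                              j≢i (vs-injective (trans (sym x≡vsⱼ) (sym vsᵢ≡x))))))
  ... | false = sym (parity-false (λ j → ⌊⌋-no (x ≟ vs j) (λ x≡vsⱼ →
                  true≢false (trans (sym (Equivalence.from (cut-tree-edges x x≢r) (j , sym x≡vsⱼ))) e))))
    where
    true≢false : true ≢ false
    true≢false ()

  depthParity-root : depthParity (root T) ≡ false
  depthParity-root = parity-false (λ i → root∉desc T (vs≢root i))

  depthParity-parent : ∀ x → x ≢ root T → depthParity x ≡ treeEdgeInCut T A x xor depthParity (parent T x)
  depthParity-parent x x≢r =
    trans (Parity.sum-cong-≗ (λ i → ∈desc-parent T x≢r (vs≢root i)))
          (trans (Parity.∑-distrib-+ (λ i → ⌊ x ≟ vs i ⌋) (λ i → parent T x ∈ᵇ desc T (vs i)))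
                 (cong (_xor depthParity (parent T x)) (sym (treeEdgeInCut≡parity x x≢r))))

  ∈A-xor-depthParity : ∀ x → x ∈ᵇ A xor depthParity x ≡ root T ∈ᵇ A
  ∈A-xor-depthParity = tree-induction T (λ x → x ∈ᵇ A xor depthParity x ≡ root T ∈ᵇ A)
    (trans (cong (root T ∈ᵇ A xor_) depthParity-root) (xor-identityʳ _))
    (λ x x≢r IH → begin
        x ∈ᵇ A xor depthParity x
      ≡⟨ cong (x ∈ᵇ A xor_) (depthParity-parent x x≢r) ⟩
        x ∈ᵇ A xor ((x ∈ᵇ A xor parent T x ∈ᵇ A) xor depthParity (parent T x))
      ≡⟨ cong (x ∈ᵇ A xor_) (xor-assoc (x ∈ᵇ A) _ _) ⟩
        x ∈ᵇ A xor (x ∈ᵇ A xor (parent T x ∈ᵇ A xor depthParity (parent T x)))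
      ≡⟨ xor-cancelˡ (x ∈ᵇ A) _ ⟩
        parent T x ∈ᵇ A xor depthParity (parent T x)
      ≡⟨ IH ⟩
        root T ∈ᵇ A
      ∎)
    where open ≡-Reasoning

  ∈A≡root-xor-depthParity : ∀ x → x ∈ᵇ A ≡ root T ∈ᵇ A xor depthParity x
  ∈A≡root-xor-depthParity x =
    sym (trans (cong (_xor depthParity x) (sym (∈A-xor-depthParity x))) (xor-cancelʳ (x ∈ᵇ A) (depthParity x)))

  inCut≡parity : ∀ e → inCut A e ≡ parity (λ i → inCut (desc T (vs i)) e)
  inCut≡parity (u , w) = begin
      u ∈ᵇ A xor w ∈ᵇ A
    ≡⟨ cong₂ _xor_ (∈A≡root-xor-depthParity u) (∈A≡root-xor-depthParity w) ⟩
      (root T ∈ᵇ A xor depthParity u) xor (root T ∈ᵇ A xor depthParity w)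
    ≡⟨ xor-cancel-common (root T ∈ᵇ A) (depthParity u) (depthParity w) ⟩
      depthParity u xor depthParity w
    ≡⟨ sym (Parity.∑-distrib-+ (λ i → u ∈ᵇ desc T (vs i)) (λ i → w ∈ᵇ desc T (vs i))) ⟩
      parity (λ i → inCut (desc T (vs i)) (u , w))
    ∎
    where open ≡-Reasoning

theorem1p1 : ∀ {n k : ℕ} (G : Graph n) (T : RootedSpanningTree G) (A : Subset n)
    (vs : Fin k → Fin n)
    → Injective _≡_ _≡_ vs
    → (∀ i → vs i ≢ root T)
    → (∀ v → v ≢ root T → (treeEdgeInCut T A v ≡ true ⇔ ∃ λ i → vs i ≡ v))
    → + cutSize G A ≡ rhs T vs
theorem1p1 {n} {k} G T A vs vs-injective vs≢root cut-tree-edges = begin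
    + length (filterᵇ (inCut A) (edges G))
  ≡⟨ cong (λ es → + length es)
          (filterᵇ-cong (inCut≡parity T A vs vs-injective vs≢root cut-tree-edges) (edges G)) ⟩
    + length (filterᵇ (parity ∘ subtreeCuts) (edges G))
  ≡⟨ sym (alternatingSum-layerCount subtreeCuts (edges G)) ⟩
    alternatingSum (layerCount subtreeCuts (edges G)) k
  ≡⟨ sym (foldr-upTo≡alternatingSum (layerSum T vs) k) ⟩
    rhs T vs
  ∎
  where
  open ≡-Reasoning
  subtreeCuts : Fin n × Fin n → Fin k → Bool
  subtreeCuts e i = inCut (desc T (vs i)) e
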